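{- Let $G=(V,E)$ be a finite simple graph and let $C\subseteq V$ be a minimum vertex cover of $G$. Then $C$ is the unique minimum vertex cover of $G$ if and only if for every nonempty independent set $A\subseteq C$ we have $|N_{V-C}(A)|>|A|$.
   Context: For a vertex $v$, $N(v)$ is its set of neighbors; for $X\subseteq V$, $N(X)=\bigcup_{x\in X}N(x)$, and for $S\subseteq V$, $N_S(X)=N(X)\cap S$. A vertex cover is a set of vertices meeting every edge; a minimum vertex cover is one of smallest size. -}

module Defs where

open import Data.Nat using (ℕ; zero; suc; _≤_)
open import Data.Bool using (Bool; true; false; _∧_; _∨_; T)
open import Data.Fin using (Fin; zero; suc)
open import Data.Fin.Subset using (Subset; _∈_; _∉_; _∩_; ∣_∣)
open import Data.Vec using (tabulate; lookup)
open import Data.Product using (_×_)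
open import Data.Sum using (_⊎_)
open import Relation.Nullary using (¬_)
open import Relation.Binary.PropositionalEquality using (_≡_)

record SimpleGraph (n : ℕ) : Set where
  field
    adj    : Fin n → Fin n → Bool
    sym    : ∀ u v → adj u v ≡ adj v u
    irrefl : ∀ v → adj v v ≡ false

open SimpleGraph public

Edge : ∀ {n} → SimpleGraph n → Fin n → Fin n → Set
Edge G u v = T (adj G u v)

anyFin : ∀ {n} → (Fin n → Bool) → Bool
anyFin {zero}  f = false
anyFin {suc n} f = f zero ∨ anyFin (λ i → f (suc i))

N : ∀ {n} → SimpleGraph n → Subset n → Subset n
N G X = tabulate (λ v → anyFin (λ u → lookup X u ∧ adj G u v))

NS : ∀ {n} → SimpleGraph n → Subset n → Subset n → Subset n
NS G S X = N G X ∩ S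

IsVertexCover : ∀ {n} → SimpleGraph n → Subset n → Set
IsVertexCover G C = ∀ u v → Edge G u v → u ∈ C ⊎ v ∈ C

IsMinimumVertexCover : ∀ {n} → SimpleGraph n → Subset n → Set
IsMinimumVertexCover G C =
  IsVertexCover G C × (∀ D → IsVertexCover G D → ∣ C ∣ ≤ ∣ D ∣)

IsIndependent : ∀ {n} → SimpleGraph n → Subset n → Set
IsIndependent G A = ∀ u v → u ∈ A → v ∈ A → ¬ Edge G u v

IsUniqueMinimumVertexCover : ∀ {n} → SimpleGraph n → Subset n → Set
IsUniqueMinimumVertexCover G C =
  IsMinimumVertexCover G C × (∀ D → IsMinimumVertexCover G D → D ≡ C)

-- If C is a vertex cover and A ⊆ C is independent, then (C ∖ A) ∪ N_{V∖C}(A)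
-- is again a vertex cover. So an independent A ⊆ C with |N_{V∖C}(A)| ≤ |A|
-- yields a second minimum cover avoiding A. Conversely, if D ≠ C is another
-- minimum cover, A = C ∖ D is independent (it misses the cover D) and
-- N_{V∖C}(A) ⊆ D ∖ C, so |N_{V∖C}(A)| > |A| would force |D| > |C|.
module Submission where

open import Defs hiding (sym)
open import Data.Nat using (ℕ; _<_; _≤_; _+_; suc; z≤n; s≤s)
open import Data.Nat.Properties
  using (≤-trans; n≤1+n; +-suc; +-comm; +-monoʳ-≤; +-monoʳ-<; <-≤-trans; <⇒≱; ≮⇒≥; _<?_; module ≤-Reasoning)
open import Data.Bool using (Bool; true; false; _∧_; T)
open import Data.Bool.Properties using (T-≡; T-∧; T-∨)
open import Data.Fin using (Fin; zero; suc)
open import Data.Fin.Subset using (Subset; _⊆_; ∁; ∣_∣; Nonempty; _∈_; _∉_; _∩_; _∪_)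
open import Data.Fin.Subset.Properties
  using (_∈?_; nonempty?; x∈p∩q⁺; x∈p∩q⁻; x∈p∪q⁺; x∈p∪q⁻; x∈∁p⇒x∉p; x∉p⇒x∈∁p;
         p⊆q⇒∣p∣≤∣q∣; p⊂q⇒∣p∣<∣q∣; p∩q⊆p; ∩-comm; ⊆-antisym)
open import Data.Vec using ([]; _∷_; lookup)
open import Data.Vec.Properties using ([]=⇒lookup; lookup⇒[]=; lookup∘tabulate)
open import Data.Product using (_×_; _,_; ∃; proj₂)
open import Data.Sum using (_⊎_; inj₁; inj₂; swap)
open import Data.Empty using (⊥-elim)
open import Function.Bundles using (_⇔_; mk⇔; Equivalence)
open import Relation.Nullary using (yes; no)
open import Relation.Binary.PropositionalEquality
  using (_≡_; refl; sym; trans; cong; subst; subst₂)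

private
  variable
    n : ℕ

∣p∣≡∣p∩q∣+∣p∩∁q∣ : (p q : Subset n) → ∣ p ∣ ≡ ∣ p ∩ q ∣ + ∣ p ∩ ∁ q ∣
∣p∣≡∣p∩q∣+∣p∩∁q∣ []          []          = refl
∣p∣≡∣p∩q∣+∣p∩∁q∣ (false ∷ p) (_ ∷ q)     = ∣p∣≡∣p∩q∣+∣p∩∁q∣ p q
∣p∣≡∣p∩q∣+∣p∩∁q∣ (true ∷ p)  (true ∷ q)  = cong suc (∣p∣≡∣p∩q∣+∣p∩∁q∣ p q)
∣p∣≡∣p∩q∣+∣p∩∁q∣ (true ∷ p)  (false ∷ q) =
  trans (cong suc (∣p∣≡∣p∩q∣+∣p∩∁q∣ p q)) (sym (+-suc _ _))

∣p∪q∣≤∣p∣+∣q∣ : (p q : Subset n) → ∣ p ∪ q ∣ ≤ ∣ p ∣ + ∣ q ∣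
∣p∪q∣≤∣p∣+∣q∣ []          []          = z≤n
∣p∪q∣≤∣p∣+∣q∣ (false ∷ p) (false ∷ q) = ∣p∪q∣≤∣p∣+∣q∣ p q
∣p∪q∣≤∣p∣+∣q∣ (false ∷ p) (true ∷ q)  =
  subst (suc ∣ p ∪ q ∣ ≤_) (sym (+-suc _ _)) (s≤s (∣p∪q∣≤∣p∣+∣q∣ p q))
∣p∪q∣≤∣p∣+∣q∣ (true ∷ p)  (false ∷ q) = s≤s (∣p∪q∣≤∣p∣+∣q∣ p q)
∣p∪q∣≤∣p∣+∣q∣ (true ∷ p)  (true ∷ q)  =
  s≤s (≤-trans (∣p∪q∣≤∣p∣+∣q∣ p q) (+-monoʳ-≤ ∣ p ∣ (n≤1+n _)))

∣p∩∁q∣<∣q∩∁p∣⇒∣p∣<∣q∣ : (p q : Subset n) → ∣ p ∩ ∁ q ∣ < ∣ q ∩ ∁ p ∣ → ∣ p ∣ < ∣ q ∣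
∣p∩∁q∣<∣q∩∁p∣⇒∣p∣<∣q∣ p q lt =
  subst₂ _<_ (sym (∣p∣≡∣p∩q∣+∣p∩∁q∣ p q))
    (trans (cong (λ r → ∣ r ∣ + ∣ q ∩ ∁ p ∣) (∩-comm p q)) (sym (∣p∣≡∣p∩q∣+∣p∩∁q∣ q p)))
    (+-monoʳ-< ∣ p ∩ q ∣ lt)

p⊆q∧∣q∣≤∣p∣⇒p≡q : {p q : Subset n} → p ⊆ q → ∣ q ∣ ≤ ∣ p ∣ → p ≡ q
p⊆q∧∣q∣≤∣p∣⇒p≡q {p = p} p⊆q ∣q∣≤∣p∣ = ⊆-antisym p⊆q q⊆p
  where
  q⊆p : _ ⊆ p
  q⊆p {x} x∈q with x ∈? p
  ... | yes x∈p = x∈p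
  ... | no  x∉p = ⊥-elim (<⇒≱ (p⊂q⇒∣p∣<∣q∣ (p⊆q , x , x∈q , x∉p)) ∣q∣≤∣p∣)

∈⇒T-lookup : {x : Fin n} {p : Subset n} → x ∈ p → T (lookup p x)
∈⇒T-lookup x∈p = Equivalence.from T-≡ ([]=⇒lookup x∈p)

T-lookup⇒∈ : {x : Fin n} {p : Subset n} → T (lookup p x) → x ∈ p
T-lookup⇒∈ {x = x} {p} t = lookup⇒[]= x p (Equivalence.to T-≡ t)

anyFin⁺ : (f : Fin n → Bool) (u : Fin n) → T (f u) → T (anyFin f)
anyFin⁺ f zero    t = Equivalence.from T-∨ (inj₁ t)
anyFin⁺ f (suc u) t = Equivalence.from T-∨ (inj₂ (anyFin⁺ (λ i → f (suc i)) u t))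

anyFin⁻ : (f : Fin n → Bool) → T (anyFin f) → ∃ λ u → T (f u)
anyFin⁻ {suc n} f t with Equivalence.to T-∨ t
... | inj₁ t₀ = zero , t₀
... | inj₂ ts with anyFin⁻ (λ i → f (suc i)) ts
...   | u , tu = suc u , tu

module _ (G : SimpleGraph n) where

  Edge-sym : ∀ {u v} → Edge G u v → Edge G v u
  Edge-sym {u} {v} = subst T (SimpleGraph.sym G u v)

  ∈N⁺ : ∀ {A u v} → u ∈ A → Edge G u v → v ∈ N G A
  ∈N⁺ {A} {u} {v} u∈A e = T-lookup⇒∈ (subst T (sym (lookup∘tabulate _ v))
    (anyFin⁺ (λ w → lookup A w ∧ adj G w v) u (Equivalence.from T-∧ (∈⇒T-lookup u∈A , e))))

  ∈N⁻ : ∀ {A v} → v ∈ N G A → ∃ λ u → u ∈ A × Edge G u v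
  ∈N⁻ {A} {v} v∈N
    with anyFin⁻ (λ w → lookup A w ∧ adj G w v) (subst T (lookup∘tabulate _ v) (∈⇒T-lookup v∈N))
  ... | u , t with Equivalence.to T-∧ t
  ...   | u∈A , e = u , T-lookup⇒∈ u∈A , e

  IsIndependent-∩∁cover : ∀ {D} → IsVertexCover G D → (C : Subset n) → IsIndependent G (C ∩ ∁ D)
  IsIndependent-∩∁cover D-cover C u v u∈A v∈A e with D-cover u v e
  ... | inj₁ u∈D = x∈∁p⇒x∉p (proj₂ (x∈p∩q⁻ C _ u∈A)) u∈D
  ... | inj₂ v∈D = x∈∁p⇒x∉p (proj₂ (x∈p∩q⁻ C _ v∈A)) v∈D

  N⊆cover : ∀ {A D} → IsVertexCover G D → (∀ {u} → u ∈ A → u ∉ D) → N G A ⊆ D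
  N⊆cover D-cover A-misses-D v∈N with ∈N⁻ v∈N
  ... | u , u∈A , e with D-cover u _ e
  ...   | inj₁ u∈D = ⊥-elim (A-misses-D u∈A u∈D)
  ...   | inj₂ v∈D = v∈D

  exchange : Subset n → Subset n → Subset n
  exchange C A = (C ∩ ∁ A) ∪ NS G (∁ C) A

  exchange-covers-edges-at : ∀ {C A} → IsIndependent G A → ∀ {u v} → u ∈ C → Edge G u v →
                             u ∈ exchange C A ⊎ v ∈ exchange C A
  exchange-covers-edges-at {C} {A} A-indep {u} {v} u∈C e with u ∈? A
  ... | no u∉A = inj₁ (x∈p∪q⁺ (inj₁ (x∈p∩q⁺ (u∈C , x∉p⇒x∈∁p u∉A))))
  ... | yes u∈A with v ∈? C
  ...   | no v∉C = inj₂ (x∈p∪q⁺ (inj₂ (x∈p∩q⁺ (∈N⁺ u∈A e , x∉p⇒x∈∁p v∉C))))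
  ...   | yes v∈C with v ∈? A
  ...     | yes v∈A = ⊥-elim (A-indep u v u∈A v∈A e)
  ...     | no v∉A  = inj₂ (x∈p∪q⁺ (inj₁ (x∈p∩q⁺ (v∈C , x∉p⇒x∈∁p v∉A))))

  exchange-IsVertexCover : ∀ {C A} → IsVertexCover G C → IsIndependent G A →
                           IsVertexCover G (exchange C A)
  exchange-IsVertexCover C-cover A-indep u v e with C-cover u v e
  ... | inj₁ u∈C = exchange-covers-edges-at A-indep u∈C e
  ... | inj₂ v∈C = swap (exchange-covers-edges-at A-indep v∈C (Edge-sym e))

  ∣exchange∣≤∣C∣ : ∀ {C A} → A ⊆ C → ∣ NS G (∁ C) A ∣ ≤ ∣ A ∣ → ∣ exchange C A ∣ ≤ ∣ C ∣
  ∣exchange∣≤∣C∣ {C} {A} A⊆C ∣N∣≤∣A∣ = begin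
    ∣ exchange C A ∣                   ≤⟨ ∣p∪q∣≤∣p∣+∣q∣ (C ∩ ∁ A) (NS G (∁ C) A) ⟩
    ∣ C ∩ ∁ A ∣ + ∣ NS G (∁ C) A ∣     ≤⟨ +-monoʳ-≤ ∣ C ∩ ∁ A ∣ (≤-trans ∣N∣≤∣A∣ ∣A∣≤∣C∩A∣) ⟩
    ∣ C ∩ ∁ A ∣ + ∣ C ∩ A ∣            ≡⟨ +-comm ∣ C ∩ ∁ A ∣ ∣ C ∩ A ∣ ⟩
    ∣ C ∩ A ∣ + ∣ C ∩ ∁ A ∣            ≡⟨ sym (∣p∣≡∣p∩q∣+∣p∩∁q∣ C A) ⟩
    ∣ C ∣                              ∎
    where
    open ≤-Reasoning
    ∣A∣≤∣C∩A∣ : ∣ A ∣ ≤ ∣ C ∩ A ∣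
    ∣A∣≤∣C∩A∣ = p⊆q⇒∣p∣≤∣q∣ (λ x∈A → x∈p∩q⁺ (A⊆C x∈A , x∈A))

  ∉exchange : ∀ {C A x} → x ∈ C → x ∈ A → x ∉ exchange C A
  ∉exchange {C} {A} x∈C x∈A x∈X with x∈p∪q⁻ (C ∩ ∁ A) (NS G (∁ C) A) x∈X
  ... | inj₁ x∈C∖A = x∈∁p⇒x∉p (proj₂ (x∈p∩q⁻ C (∁ A) x∈C∖A)) x∈A
  ... | inj₂ x∈NS  = x∈∁p⇒x∉p (proj₂ (x∈p∩q⁻ (N G A) (∁ C) x∈NS)) x∈C

  IsMinimumVertexCover-≤ : ∀ {C D} → IsMinimumVertexCover G C → IsVertexCover G D →
                           ∣ D ∣ ≤ ∣ C ∣ → IsMinimumVertexCover G D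
  IsMinimumVertexCover-≤ (_ , C-min) D-cover ∣D∣≤∣C∣ =
    D-cover , λ E E-cover → ≤-trans ∣D∣≤∣C∣ (C-min E E-cover)

  ExpandsIntoComplement : Subset n → Set
  ExpandsIntoComplement C =
    ∀ A → A ⊆ C → Nonempty A → IsIndependent G A → ∣ A ∣ < ∣ NS G (∁ C) A ∣

  unique⇒expands : ∀ {C} → IsUniqueMinimumVertexCover G C → ExpandsIntoComplement C
  unique⇒expands {C} ((C-cover , C-min) , unique) A A⊆C (x , x∈A) A-indep
    with ∣ A ∣ <? ∣ NS G (∁ C) A ∣
  ... | yes ∣A∣<∣N∣ = ∣A∣<∣N∣
  ... | no  ∣A∣≮∣N∣ = ⊥-elim (∉exchange (A⊆C x∈A) x∈A (subst (x ∈_) (sym exchange≡C) (A⊆C x∈A)))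
    where
    exchange≡C : exchange C A ≡ C
    exchange≡C = unique (exchange C A)
      (IsMinimumVertexCover-≤ (C-cover , C-min) (exchange-IsVertexCover C-cover A-indep)
        (∣exchange∣≤∣C∣ A⊆C (≮⇒≥ ∣A∣≮∣N∣)))

  expands⇒unique : ∀ {C} → IsMinimumVertexCover G C → ExpandsIntoComplement C →
                   ∀ D → IsMinimumVertexCover G D → D ≡ C
  expands⇒unique {C} (C-cover , _) expands D (D-cover , D-min) with nonempty? (C ∩ ∁ D)
  ... | no  C∖D-empty = sym (p⊆q∧∣q∣≤∣p∣⇒p≡q C⊆D (D-min C C-cover))
    where
    C⊆D : C ⊆ D
    C⊆D {x} x∈C with x ∈? D
    ... | yes x∈D = x∈D
    ... | no  x∉D = ⊥-elim (C∖D-empty (x , x∈p∩q⁺ (x∈C , x∉p⇒x∈∁p x∉D)))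
  ... | yes C∖D-nonempty = ⊥-elim (<⇒≱ (∣p∩∁q∣<∣q∩∁p∣⇒∣p∣<∣q∣ C D ∣C∖D∣<∣D∖C∣) (D-min C C-cover))
    where
    C∖D-misses-D : ∀ {u} → u ∈ C ∩ ∁ D → u ∉ D
    C∖D-misses-D u∈C∖D = x∈∁p⇒x∉p (proj₂ (x∈p∩q⁻ C (∁ D) u∈C∖D))
    NS⊆D∖C : NS G (∁ C) (C ∩ ∁ D) ⊆ D ∩ ∁ C
    NS⊆D∖C x∈NS with x∈p∩q⁻ (N G (C ∩ ∁ D)) (∁ C) x∈NS
    ... | x∈N , x∈∁C = x∈p∩q⁺ (N⊆cover D-cover C∖D-misses-D x∈N , x∈∁C)
    ∣C∖D∣<∣D∖C∣ : ∣ C ∩ ∁ D ∣ < ∣ D ∩ ∁ C ∣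
    ∣C∖D∣<∣D∖C∣ = <-≤-trans
      (expands (C ∩ ∁ D) (p∩q⊆p C (∁ D)) C∖D-nonempty (IsIndependent-∩∁cover D-cover C))
      (p⊆q⇒∣p∣≤∣q∣ NS⊆D∖C)

theorem2p2 : (n : ℕ) (G : SimpleGraph n) (C : Subset n) →
    IsMinimumVertexCover G C →
    (IsUniqueMinimumVertexCover G C ⇔
      (∀ (A : Subset n) → A ⊆ C → Nonempty A → IsIndependent G A →
        ∣ A ∣ < ∣ NS G (∁ C) A ∣))
theorem2p2 n G C C-min =
  mk⇔ (unique⇒expands G) (λ expands → C-min , expands⇒unique G C-min expands)
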